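{- A finite simple graph $G$ is matrogenic if and only if the following holds: for every alternating 4-cycle $\langle a,b:c,d\rangle$ in $G$, if $H$ is the graph obtained from $G$ by the 2-switch on $\langle a,b:c,d\rangle$, then both $\phi_{ac}$ and $\phi_{bd}$ are isomorphisms from $G$ to $H$.
   Context: An alternating 4-cycle $\langle a,b:c,d\rangle$ in $G$ consists of four distinct vertices with $ab,cd\in E(G)$ and $bc,ad\notin E(G)$; the 2-switch on it deletes $ab,cd$ and adds $bc,ad$ (so $H$ has the same vertex set as $G$). For vertices $u,v$, $\phi_{uv}:V(G)\to V(G)$ is the bijection that exchanges $u$ and $v$ and fixes every other vertex. A graph $G$ is matrogenic if the vertex sets of the alternating 4-cycles of $G$ form the set of circuits of a matroid on $V(G)$; it is known (Földes–Hammer) that equivalently, $G$ contains no alternating 4-cycle $\langle a,b:c,d\rangle$ together with a vertex $u\notin\{a,b,c,d\}$ that is adjacent to $a$ and not adjacent to $c$. -}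

module Defs where

open import Data.Nat using (ℕ)
open import Data.Bool using (Bool; true; false; if_then_else_; _∨_; _∧_)
open import Data.Fin using (Fin; _≟_)
open import Data.Fin.Subset using (Subset; ⁅_⁆; _∪_; _⊆_; _∈_; _-_) renaming (⊥ to ∅)
open import Data.Product using (Σ; _×_; ∃; ∃-syntax; _,_)
open import Relation.Nullary using (¬_; does)
open import Relation.Binary.PropositionalEquality using (_≡_; _≢_)
open import Function.Definitions using (Bijective)
open import Function.Bundles using (_⇔_)

record Graph (n : ℕ) : Set where
  field
    adj   : Fin n → Fin n → Bool
    sym   : ∀ x y → adj x y ≡ adj y x
    irref : ∀ x → adj x x ≡ false
open Graph public

record Alt4 {n : ℕ} (G : Graph n) (a b c d : Fin n) : Set where
  field
    a≢b : a ≢ b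
    a≢c : a ≢ c
    a≢d : a ≢ d
    b≢c : b ≢ c
    b≢d : b ≢ d
    c≢d : c ≢ d
    ab∈E : adj G a b ≡ true
    cd∈E : adj G c d ≡ true
    bc∉E : adj G b c ≡ false
    ad∉E : adj G a d ≡ false

samePair : {n : ℕ} → Fin n → Fin n → Fin n → Fin n → Bool
samePair x y u v =
  (does (x ≟ u) ∧ does (y ≟ v)) ∨ (does (x ≟ v) ∧ does (y ≟ u))

switchAdj : {n : ℕ} → Graph n → (a b c d : Fin n) → Fin n → Fin n → Bool
switchAdj G a b c d x y =
  if samePair x y a b ∨ samePair x y c d then false
  else if samePair x y b c ∨ samePair x y a d then true
  else adj G x y

φ : {n : ℕ} → Fin n → Fin n → Fin n → Fin n
φ u v x = if does (x ≟ u) then v else if does (x ≟ v) then u else x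

IsIso : {n : ℕ} → (Fin n → Fin n → Bool) → (Fin n → Fin n → Bool) →
        (Fin n → Fin n) → Set
IsIso adjG adjH f = Bijective _≡_ _≡_ f × (∀ x y → adjG x y ≡ adjH (f x) (f y))

IsCircuitFamily : {n : ℕ} → (Subset n → Set) → Set
IsCircuitFamily {n} 𝒞 =
    (¬ 𝒞 ∅)
  × (∀ X Y → 𝒞 X → 𝒞 Y → X ⊆ Y → X ≡ Y)
  × (∀ X Y (e : Fin n) → 𝒞 X → 𝒞 Y → X ≢ Y → e ∈ X → e ∈ Y →
       ∃[ Z ] (𝒞 Z × Z ⊆ ((X ∪ Y) - e)))

quad : {n : ℕ} → Fin n → Fin n → Fin n → Fin n → Subset n
quad a b c d = ⁅ a ⁆ ∪ ⁅ b ⁆ ∪ ⁅ c ⁆ ∪ ⁅ d ⁆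

AltSets : {n : ℕ} → Graph n → Subset n → Set
AltSets G S = ∃[ a ] ∃[ b ] ∃[ c ] ∃[ d ] (Alt4 G a b c d × S ≡ quad a b c d)

Matrogenic : {n : ℕ} → Graph n → Set
Matrogenic G = IsCircuitFamily (AltSets G)

SwitchIsoProperty : {n : ℕ} → Graph n → Set
SwitchIsoProperty G = ∀ a b c d → Alt4 G a b c d →
  IsIso (adj G) (switchAdj G a b c d) (φ a c)
  × IsIso (adj G) (switchAdj G a b c d) (φ b d)

-- Say that a and c, and likewise b and d, are opposite twins in an alternating 4-cycle
-- ⟨a,b:c,d⟩ if every vertex outside {a,b,c,d} is adjacent to both of them or to neither;
-- the Földes–Hammer forbidden configuration is precisely a failure of this, and both sides
-- of the equivalence turn out to say that all opposite vertices are twins.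
-- The 2-switch changes only pairs inside {a,b,c,d}, where φ_ac maps the adjacencies of G
-- onto those of H by inspection, so φ_ac is an isomorphism exactly when a and c are twins;
-- φ_bd is the same statement for ⟨b,a:d,c⟩.
-- A matroid with these circuits eliminates d from {a,b,c,d} and {u,a,d,c}, for u adjacent
-- to a but not to c, leaving a circuit inside {a,b,c,u}; but no alternating 4-cycle fits there.
-- Conversely, given twins, two distinct alternating 4-cycles ⟨e,b:c,d⟩ and ⟨e,p:q,r⟩ yield a
-- third one avoiding e: typically c can take the place of e in the second cycle (or q in the
-- first), and the remaining ways the two cycles can overlap are settled one by one.
-- Minimality of the circuits just says that four distinct vertices fill a four-element set.

module Submission where

open import Defs hiding (sym)
open import Data.Nat using (ℕ)
open import Data.Bool using (Bool; true; false; _∨_; _∧_)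
open import Data.Bool.Properties using (∨-comm; ∧-comm; ∧-zeroʳ)
open import Data.Fin using (Fin; _≟_)
open import Data.Fin.Subset using (Subset; _∪_; _⊆_; _∈_; _∉_; _-_; _─_; inside) renaming (⊥ to ∅)
open import Data.Fin.Subset.Properties
  using ( x∈⁅x⁆; x∈⁅y⁆⇒x≡y; x∈p∪q⁻; x∈p∪q⁺; x∈p∧x≢y⇒x∈p-y; p─q⊆p; ⊆-antisym; ∉⊥
        ; ∪-commutativeMonoid )
open import Data.Vec using (_∷_; here; there)
open import Data.Product using (_×_; ∃-syntax; _,_; proj₁; proj₂)
open import Data.Sum using (_⊎_; inj₁; inj₂)
import Data.Sum as Sum
open import Data.Empty using (⊥; ⊥-elim)
open import Relation.Nullary using (¬_; Dec; does; yes; no)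
open import Relation.Nullary.Decidable using (dec-true; dec-false; decidable-stable)
open import Relation.Binary.PropositionalEquality
  using (_≡_; _≢_; refl; sym; trans; cong; cong₂; subst; ≢-sym; module ≡-Reasoning)
open import Function.Definitions using (Bijective)
open import Function.Bundles using (_⇔_; mk⇔)

private variable
  n : ℕ
  a b c d e p q r s u v x y : Fin n

Among₂ : Fin n → Fin n → Fin n → Set
Among₂ v r s = v ≡ r ⊎ v ≡ s

Among₃ : Fin n → Fin n → Fin n → Fin n → Set
Among₃ v q r s = v ≡ q ⊎ Among₂ v r s

Among : Fin n → Fin n → Fin n → Fin n → Fin n → Set
Among v p q r s = v ≡ p ⊎ Among₃ v q r s

pattern at₁ e = inj₁ e
pattern at₂ e = inj₂ (inj₁ e)
pattern at₃ e = inj₂ (inj₂ (inj₁ e))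
pattern at₄ e = inj₂ (inj₂ (inj₂ e))

Outside : Fin n → Fin n → Fin n → Fin n → Fin n → Set
Outside v a b c d = v ≢ a × v ≢ b × v ≢ c × v ≢ d

among₃? : (v q r s : Fin n) → Among₃ v q r s ⊎ (v ≢ q × v ≢ r × v ≢ s)
among₃? v q r s with v ≟ q | v ≟ r | v ≟ s
... | yes v≡q | _ | _ = inj₁ (inj₁ v≡q)
... | no _ | yes v≡r | _ = inj₁ (inj₂ (inj₁ v≡r))
... | no _ | no _ | yes v≡s = inj₁ (inj₂ (inj₂ v≡s))
... | no v≢q | no v≢r | no v≢s = inj₂ (v≢q , v≢r , v≢s)

among? : (v a b c d : Fin n) → Among v a b c d ⊎ Outside v a b c d
among? v a b c d with v ≟ a
... | yes v≡a = inj₁ (inj₁ v≡a)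
... | no v≢a = Sum.map inj₂ (v≢a ,_) (among₃? v b c d)

drop-≢ : ∀ {A : Set} → v ≡ p ⊎ A → v ≢ p → A
drop-≢ (inj₁ v≡p) v≢p = ⊥-elim (v≢p v≡p)
drop-≢ (inj₂ a)   _   = a

record Distinct (a b c d : Fin n) : Set where
  constructor distinct
  field
    a≢b : a ≢ b
    a≢c : a ≢ c
    a≢d : a ≢ d
    b≢c : b ≢ c
    b≢d : b ≢ d
    c≢d : c ≢ d

pigeonhole₂ : a ≢ b → a ≢ c → b ≢ c → Among₂ a r s → Among₂ b r s → Among₂ c r s → ⊥
pigeonhole₂ a≢b _   _   (inj₁ refl) (inj₁ refl) _           = a≢b refl
pigeonhole₂ a≢b _   _   (inj₂ refl) (inj₂ refl) _           = a≢b refl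
pigeonhole₂ _   a≢c _   (inj₁ refl) _           (inj₁ refl) = a≢c refl
pigeonhole₂ _   a≢c _   (inj₂ refl) _           (inj₂ refl) = a≢c refl
pigeonhole₂ _   _   b≢c _           (inj₁ refl) (inj₁ refl) = b≢c refl
pigeonhole₂ _   _   b≢c _           (inj₂ refl) (inj₂ refl) = b≢c refl

pigeonhole₃ : Distinct a b c d →
              Among₃ a q r s → Among₃ b q r s → Among₃ c q r s → Among₃ d q r s → ⊥
pigeonhole₃ (distinct a≢b a≢c a≢d b≢c b≢d c≢d) (inj₁ refl) b∈ c∈ d∈ =
  pigeonhole₂ b≢c b≢d c≢d (drop-≢ b∈ (≢-sym a≢b)) (drop-≢ c∈ (≢-sym a≢c))
                          (drop-≢ d∈ (≢-sym a≢d))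
pigeonhole₃ (distinct _ a≢c a≢d b≢c b≢d c≢d) (inj₂ a∈) (inj₁ refl) c∈ d∈ =
  pigeonhole₂ a≢c a≢d c≢d a∈ (drop-≢ c∈ (≢-sym b≢c)) (drop-≢ d∈ (≢-sym b≢d))
pigeonhole₃ (distinct a≢b _ a≢d _ b≢d c≢d) (inj₂ a∈) (inj₂ b∈) (inj₁ refl) d∈ =
  pigeonhole₂ a≢b a≢d b≢d a∈ b∈ (drop-≢ d∈ (≢-sym c≢d))
pigeonhole₃ (distinct a≢b a≢c _ b≢c _ _) (inj₂ a∈) (inj₂ b∈) (inj₂ c∈) _ =
  pigeonhole₂ a≢b a≢c b≢c a∈ b∈ c∈

quad⁻ : v ∈ quad a b c d → Among v a b c d
quad⁻ {a = a} {b} {c} {d} i with x∈p∪q⁻ _ _ i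
... | inj₁ j = at₁ (x∈⁅y⁆⇒x≡y a j)
... | inj₂ j with x∈p∪q⁻ _ _ j
...   | inj₁ k = at₂ (x∈⁅y⁆⇒x≡y b k)
...   | inj₂ k with x∈p∪q⁻ _ _ k
...     | inj₁ l = at₃ (x∈⁅y⁆⇒x≡y c l)
...     | inj₂ l = at₄ (x∈⁅y⁆⇒x≡y d l)

quad⁺ : Among v a b c d → v ∈ quad a b c d
quad⁺ (at₁ refl) = x∈p∪q⁺ (inj₁ (x∈⁅x⁆ _))
quad⁺ (at₂ refl) = x∈p∪q⁺ (inj₂ (x∈p∪q⁺ (inj₁ (x∈⁅x⁆ _))))
quad⁺ (at₃ refl) = x∈p∪q⁺ (inj₂ (x∈p∪q⁺ (inj₂ (x∈p∪q⁺ (inj₁ (x∈⁅x⁆ _))))))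
quad⁺ (at₄ refl) = x∈p∪q⁺ (inj₂ (x∈p∪q⁺ (inj₂ (x∈p∪q⁺ (inj₂ (x∈⁅x⁆ _))))))

quad-⊆ : {S : Subset n} → a ∈ S → b ∈ S → c ∈ S → d ∈ S → quad a b c d ⊆ S
quad-⊆ a∈ b∈ c∈ d∈ i with quad⁻ i
... | at₁ refl = a∈
... | at₂ refl = b∈
... | at₃ refl = c∈
... | at₄ refl = d∈

module _ {n : ℕ} where
  open import Algebra.Solver.CommutativeMonoid (∪-commutativeMonoid n)

  quad-flip : (a b c d : Fin n) → quad a b c d ≡ quad b a d c
  quad-flip a b c d =
    solve 4 (λ a b c d → a ⊕ b ⊕ c ⊕ d ⊜ b ⊕ a ⊕ d ⊕ c) refl _ _ _ _

  quad-swap : (a b c d : Fin n) → quad a b c d ≡ quad c d a b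
  quad-swap a b c d =
    solve 4 (λ a b c d → a ⊕ b ⊕ c ⊕ d ⊜ c ⊕ d ⊕ a ⊕ b) refl _ _ _ _

  quad-reverse : (a b c d : Fin n) → quad a b c d ≡ quad d c b a
  quad-reverse a b c d =
    solve 4 (λ a b c d → a ⊕ b ⊕ c ⊕ d ⊜ d ⊕ c ⊕ b ⊕ a) refl _ _ _ _

quad-⊆⇒first∈ : Distinct a b c d → quad a b c d ⊆ quad p q r s → p ∈ quad a b c d
quad-⊆⇒first∈ {a = a} {b} {c} {d} {p = p} D sub with among? p a b c d
... | inj₁ p∈ = quad⁺ p∈
... | inj₂ (p≢a , p≢b , p≢c , p≢d) =
  ⊥-elim (pigeonhole₃ D (elsewhere (at₁ refl) p≢a) (elsewhere (at₂ refl) p≢b)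
                        (elsewhere (at₃ refl) p≢c) (elsewhere (at₄ refl) p≢d))
  where
  elsewhere : Among v a b c d → p ≢ v → Among₃ v _ _ _
  elsewhere v∈ p≢v = drop-≢ (quad⁻ (sub (quad⁺ v∈))) (≢-sym p≢v)

quad-⊆-reverse : Distinct a b c d → quad a b c d ⊆ quad p q r s → quad p q r s ⊆ quad a b c d
quad-⊆-reverse {a = a} {b} {c} {d} {p = p} {q} {r} {s} D sub =
  quad-⊆ (quad-⊆⇒first∈ D sub)
         (quad-⊆⇒first∈ D (subst (quad a b c d ⊆_) (quad-flip p q r s) sub))
         (quad-⊆⇒first∈ D (subst (quad a b c d ⊆_) (quad-swap p q r s) sub))
         (quad-⊆⇒first∈ D (subst (quad a b c d ⊆_) (quad-reverse p q r s) sub))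

x∈p─q⇒x∉q : (p q : Subset n) → x ∈ p ─ q → x ∉ q
x∈p─q⇒x∉q (_ ∷ p) (inside ∷ q) () here
x∈p─q⇒x∉q (_ ∷ p) (_ ∷ q) (there i) (there j) = x∈p─q⇒x∉q p q i j

x∈p-y⇒x≢y : (p : Subset n) → x ∈ p - y → x ≢ y
x∈p-y⇒x≢y p i refl = x∈p─q⇒x∉q p _ i (x∈⁅x⁆ _)

≡true⇒≢false : ∀ {t : Bool} → t ≡ true → t ≢ false
≡true⇒≢false refl ()

-- Alternating 4-cycles

module _ {n : ℕ} (G : Graph n) where
  open Alt4

  adj-flip : ∀ {x y t} → adj G x y ≡ t → adj G y x ≡ t
  adj-flip {x} {y} = trans (Graph.sym G y x)

  adjacent⇒≢ : adj G x y ≡ true → x ≢ y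
  adjacent⇒≢ {x} xy refl = ≡true⇒≢false xy (irref G x)

  ≢-by-adj : adj G u x ≡ true → adj G u y ≡ false → x ≢ y
  ≢-by-adj ux uy refl = ≡true⇒≢false ux uy

  alt4 : adj G a b ≡ true → adj G c d ≡ true → adj G b c ≡ false → adj G a d ≡ false →
         b ≢ c → a ≢ d → Alt4 G a b c d
  alt4 ab cd bc ad b≢c a≢d = record
    { a≢b = adjacent⇒≢ ab ; a≢c = ≢-sym (≢-by-adj (adj-flip cd) (adj-flip ad)) ; a≢d = a≢d
    ; b≢c = b≢c ; b≢d = ≢-by-adj ab ad ; c≢d = adjacent⇒≢ cd
    ; ab∈E = ab ; cd∈E = cd ; bc∉E = bc ; ad∉E = ad }

  alt4-distinct : Alt4 G a b c d → Distinct a b c d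
  alt4-distinct X = distinct (a≢b X) (a≢c X) (a≢d X) (b≢c X) (b≢d X) (c≢d X)

  alt4-flip : Alt4 G a b c d → Alt4 G b a d c
  alt4-flip X = alt4 (adj-flip (ab∈E X)) (adj-flip (cd∈E X)) (ad∉E X) (bc∉E X) (a≢d X) (b≢c X)

  alt4-swap : Alt4 G a b c d → Alt4 G c d a b
  alt4-swap X = alt4 (cd∈E X) (ab∈E X) (adj-flip (ad∉E X)) (adj-flip (bc∉E X))
                     (≢-sym (a≢d X)) (≢-sym (b≢c X))

  alt4-reverse : Alt4 G a b c d → Alt4 G d c b a
  alt4-reverse X = alt4-swap (alt4-flip X)

  altSets-nonempty : ¬ AltSets G ∅
  altSets-nonempty (a , _ , _ , _ , _ , ∅≡abcd) =
    ∉⊥ (subst (a ∈_) (sym ∅≡abcd) (quad⁺ (at₁ refl)))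

  altSets-⊆⇒≡ : ∀ S S′ → AltSets G S → AltSets G S′ → S ⊆ S′ → S ≡ S′
  altSets-⊆⇒≡ _ _ (_ , _ , _ , _ , X , refl) (_ , _ , _ , _ , _ , refl) sub =
    ⊆-antisym sub (quad-⊆-reverse (alt4-distinct X) sub)

  altSets-rooted : ∀ {S} → AltSets G S → e ∈ S →
                   ∃[ b ] ∃[ c ] ∃[ d ] (Alt4 G e b c d × S ≡ quad e b c d)
  altSets-rooted (a , b , c , d , X , refl) e∈S with quad⁻ e∈S
  ... | at₁ refl = b , c , d , X , refl
  ... | at₂ refl = a , d , c , alt4-flip X , quad-flip a b c d
  ... | at₃ refl = d , a , b , alt4-swap X , quad-swap a b c d
  ... | at₄ refl = c , b , a , alt4-reverse X , quad-reverse a b c d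

-- The 2-switch and the transposition φ

samePair-refl : (u v : Fin n) → samePair u v u v ≡ true
samePair-refl u v rewrite dec-true (u ≟ u) refl | dec-true (v ≟ v) refl = refl

samePair-sym : (x y u v : Fin n) → samePair x y u v ≡ samePair y x u v
samePair-sym x y u v = trans (∨-comm (does (x ≟ u) ∧ does (y ≟ v)) _)
                             (cong₂ _∨_ (∧-comm (does (x ≟ v)) _) (∧-comm (does (x ≟ u)) _))

samePair-comm : (x y u v : Fin n) → samePair x y u v ≡ samePair x y v u
samePair-comm x y u v = ∨-comm (does (x ≟ u) ∧ does (y ≟ v)) _

does≟∧does≟≡false : ∀ {x u y v : Fin n} → x ≢ u ⊎ y ≢ v →
                    does (x ≟ u) ∧ does (y ≟ v) ≡ false
does≟∧does≟≡false {x = x} {u} (inj₁ x≢u) rewrite dec-false (x ≟ u) x≢u = refl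
does≟∧does≟≡false {x = x} {u} {y} {v} (inj₂ y≢v)
  rewrite dec-false (y ≟ v) y≢v = ∧-zeroʳ (does (x ≟ u))

samePair-≢ : (x y u v : Fin n) → x ≢ u ⊎ y ≢ v → x ≢ v ⊎ y ≢ u → samePair x y u v ≡ false
samePair-≢ _ _ _ _ xy≢uv xy≢vu
  rewrite does≟∧does≟≡false xy≢uv | does≟∧does≟≡false xy≢vu = refl

≢-either : ∀ {u v : Fin n} x → u ≢ v → x ≢ u ⊎ x ≢ v
≢-either {u = u} x u≢v with x ≟ u
... | yes refl = inj₂ u≢v
... | no x≢u = inj₁ x≢u

samePair-diag : u ≢ v → samePair x x u v ≡ false
samePair-diag {u = u} {v = v} {x = x} u≢v =
  samePair-≢ x x u v (≢-either x u≢v) (Sum.swap (≢-either x u≢v))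

module _ {n : ℕ} (G : Graph n) where

  switchAdj-sym : (a b c d x y : Fin n) → switchAdj G a b c d x y ≡ switchAdj G a b c d y x
  switchAdj-sym a b c d x y
    rewrite samePair-sym x y a b | samePair-sym x y c d | samePair-sym x y b c | samePair-sym x y a d
          | Graph.sym G x y = refl

  switchAdj-flip : (a b c d x y : Fin n) → switchAdj G b a d c x y ≡ switchAdj G a b c d x y
  switchAdj-flip a b c d x y
    rewrite samePair-comm x y b a | samePair-comm x y d c
          | ∨-comm (samePair x y a d) (samePair x y b c) = refl

  switchAdj-outside : Outside x a b c d → ∀ y → switchAdj G a b c d x y ≡ adj G x y
  switchAdj-outside {x = x} {a = a} {b = b} {c = c} {d = d} (x≢a , x≢b , x≢c , x≢d) y
    rewrite samePair-≢ x y a b (inj₁ x≢a) (inj₁ x≢b) | samePair-≢ x y c d (inj₁ x≢c) (inj₁ x≢d)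
          | samePair-≢ x y b c (inj₁ x≢b) (inj₁ x≢c) | samePair-≢ x y a d (inj₁ x≢a) (inj₁ x≢d) = refl

  module _ {a b c d : Fin n} (D : Distinct a b c d) where
    open Distinct D

    switchAdj-diag : switchAdj G a b c d x x ≡ adj G x x
    switchAdj-diag {x = x}
      rewrite samePair-diag {x = x} a≢b | samePair-diag {x = x} c≢d
            | samePair-diag {x = x} b≢c | samePair-diag {x = x} a≢d = refl

    switchAdj-ab : switchAdj G a b c d a b ≡ false
    switchAdj-ab rewrite samePair-refl a b = refl

    switchAdj-cd : switchAdj G a b c d c d ≡ false
    switchAdj-cd
      rewrite samePair-≢ c d a b (inj₁ (≢-sym a≢c)) (inj₁ (≢-sym b≢c)) | samePair-refl c d = refl

    switchAdj-bc : switchAdj G a b c d b c ≡ true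
    switchAdj-bc
      rewrite samePair-≢ b c a b (inj₁ (≢-sym a≢b)) (inj₂ (≢-sym a≢c))
            | samePair-≢ b c c d (inj₁ b≢c) (inj₁ b≢d)
            | samePair-refl b c = refl

    switchAdj-ad : switchAdj G a b c d a d ≡ true
    switchAdj-ad
      rewrite samePair-≢ a d a b (inj₂ (≢-sym b≢d)) (inj₁ a≢b)
            | samePair-≢ a d c d (inj₁ a≢c) (inj₁ a≢d)
            | samePair-≢ a d b c (inj₁ a≢b) (inj₁ a≢c) | samePair-refl a d = refl

    switchAdj-ac : switchAdj G a b c d a c ≡ adj G a c
    switchAdj-ac
      rewrite samePair-≢ a c a b (inj₂ (≢-sym b≢c)) (inj₁ a≢b)
            | samePair-≢ a c c d (inj₁ a≢c) (inj₁ a≢d)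
            | samePair-≢ a c b c (inj₁ a≢b) (inj₁ a≢c)
            | samePair-≢ a c a d (inj₂ c≢d) (inj₁ a≢d) = refl

    switchAdj-bd : switchAdj G a b c d b d ≡ adj G b d
    switchAdj-bd
      rewrite samePair-≢ b d a b (inj₁ (≢-sym a≢b)) (inj₂ (≢-sym a≢d))
            | samePair-≢ b d c d (inj₁ b≢c) (inj₁ b≢d)
            | samePair-≢ b d b c (inj₂ (≢-sym c≢d)) (inj₁ b≢c)
            | samePair-≢ b d a d (inj₁ (≢-sym a≢b)) (inj₁ b≢d) = refl

φ-left : (u v : Fin n) → φ u v u ≡ v
φ-left u v rewrite dec-true (u ≟ u) refl = refl

φ-right : (u v : Fin n) → φ u v v ≡ u
φ-right u v with v ≟ u
... | yes v≡u = v≡u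
... | no _ rewrite dec-true (v ≟ v) refl = refl

φ-fixed : ∀ {x u v : Fin n} → x ≢ u → x ≢ v → φ u v x ≡ x
φ-fixed {x = x} {u} {v} x≢u x≢v rewrite dec-false (x ≟ u) x≢u | dec-false (x ≟ v) x≢v = refl

φ-involutive : (u v x : Fin n) → φ u v (φ u v x) ≡ x
φ-involutive u v x = by-cases (x ≟ u) (x ≟ v)
  where
  -- A `with` on x ≟ u would also abstract it inside the unfolded φ, so match on the decisions.
  by-cases : ∀ {u v x : Fin n} → Dec (x ≡ u) → Dec (x ≡ v) → φ u v (φ u v x) ≡ x
  by-cases {u = u} {v = v} (yes refl) _ = trans (cong (φ u v) (φ-left u v)) (φ-right u v)
  by-cases {u = u} {v = v} (no _) (yes refl) = trans (cong (φ u v) (φ-right u v)) (φ-left u v)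
  by-cases {u = u} {v = v} (no x≢u) (no x≢v) =
    trans (cong (φ u v) (φ-fixed x≢u x≢v)) (φ-fixed x≢u x≢v)

φ-invariant : ∀ {A : Set} (g : Fin n → A) {u v : Fin n} → g u ≡ g v → ∀ y → g (φ u v y) ≡ g y
φ-invariant g {u} {v} gu≡gv y = by-cases (y ≟ u) (y ≟ v)
  where
  by-cases : Dec (y ≡ u) → Dec (y ≡ v) → g (φ u v y) ≡ g y
  by-cases (yes refl) _ = trans (cong g (φ-left u v)) (sym gu≡gv)
  by-cases (no _) (yes refl) = trans (cong g (φ-right u v)) gu≡gv
  by-cases (no y≢u) (no y≢v) = cong g (φ-fixed y≢u y≢v)

φ-bijective : (u v : Fin n) → Bijective _≡_ _≡_ (φ u v)
φ-bijective u v = inverseᵇ⇒bijective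
  ( strictlyInverseˡ⇒inverseˡ {f⁻¹ = φ u v} (φ u v) (φ-involutive u v)
  , strictlyInverseʳ⇒inverseʳ {f⁻¹ = φ u v} (φ u v) (φ-involutive u v) )
  where open import Function.Consequences.Propositional

-- Opposite twins and the switch isomorphisms

module _ {n : ℕ} (G : Graph n) where
  open Alt4

  OppositeTwins : Set
  OppositeTwins = ∀ {a b c d v} → Alt4 G a b c d → Outside v a b c d → adj G a v ≡ adj G c v

  module SwitchIso (twins : OppositeTwins) {a b c d : Fin n} (X : Alt4 G a b c d) where
    private
      D = alt4-distinct G X

    Preserved : Fin n → Fin n → Set
    Preserved x y = adj G x y ≡ switchAdj G a b c d (φ a c x) (φ a c y)

    preserved-sym : Preserved x y → Preserved y x
    preserved-sym {x} {y} xy =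
      trans (Graph.sym G y x) (trans xy (switchAdj-sym G a b c d (φ a c x) (φ a c y)))

    preserved-via : ∀ {x′ y′} → φ a c x ≡ x′ → φ a c y ≡ y′ →
                    adj G x y ≡ switchAdj G a b c d x′ y′ → Preserved x y
    preserved-via refl refl xy = xy

    preserved-diag : ∀ x → Preserved x x
    preserved-diag x =
      trans (irref G x) (sym (trans (switchAdj-diag G D {x = φ a c x}) (irref G (φ a c x))))

    preserved-outside : Outside x a b c d → ∀ y → Preserved x y
    preserved-outside {x} x-out@(x≢a , _ , x≢c , _) y =
      preserved-via (φ-fixed x≢a x≢c) refl
        (sym (trans (switchAdj-outside G x-out (φ a c y)) (φ-invariant (adj G x) xa≡xc y)))
      where
      xa≡xc : adj G x a ≡ adj G x c
      xa≡xc = trans (Graph.sym G x a) (trans (twins X x-out) (Graph.sym G c x))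

    private
      φa = φ-left a c
      φc = φ-right a c
      φb = φ-fixed (≢-sym (a≢b X)) (b≢c X)
      φd = φ-fixed (≢-sym (a≢d X)) (≢-sym (c≢d X))

    preserved-ab : Preserved a b
    preserved-ab = preserved-via φa φb
      (trans (ab∈E X) (sym (trans (switchAdj-sym G a b c d c b) (switchAdj-bc G D))))

    preserved-ac : Preserved a c
    preserved-ac = preserved-via φa φc
      (sym (trans (switchAdj-sym G a b c d c a) (switchAdj-ac G D)))

    preserved-ad : Preserved a d
    preserved-ad = preserved-via φa φd (trans (ad∉E X) (sym (switchAdj-cd G D)))

    preserved-bc : Preserved b c
    preserved-bc = preserved-via φb φc
      (trans (bc∉E X) (sym (trans (switchAdj-sym G a b c d b a) (switchAdj-ab G D))))

    preserved-bd : Preserved b d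
    preserved-bd = preserved-via φb φd (sym (switchAdj-bd G D))

    preserved-cd : Preserved c d
    preserved-cd = preserved-via φc φd (trans (cd∈E X) (sym (switchAdj-ad G D)))

    preserved-within : Among x a b c d → Among y a b c d → Preserved x y
    preserved-within (at₁ refl) (at₁ refl) = preserved-diag a
    preserved-within (at₁ refl) (at₂ refl) = preserved-ab
    preserved-within (at₁ refl) (at₃ refl) = preserved-ac
    preserved-within (at₁ refl) (at₄ refl) = preserved-ad
    preserved-within (at₂ refl) (at₁ refl) = preserved-sym preserved-ab
    preserved-within (at₂ refl) (at₂ refl) = preserved-diag b
    preserved-within (at₂ refl) (at₃ refl) = preserved-bc
    preserved-within (at₂ refl) (at₄ refl) = preserved-bd
    preserved-within (at₃ refl) (at₁ refl) = preserved-sym preserved-ac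
    preserved-within (at₃ refl) (at₂ refl) = preserved-sym preserved-bc
    preserved-within (at₃ refl) (at₃ refl) = preserved-diag c
    preserved-within (at₃ refl) (at₄ refl) = preserved-cd
    preserved-within (at₄ refl) (at₁ refl) = preserved-sym preserved-ad
    preserved-within (at₄ refl) (at₂ refl) = preserved-sym preserved-bd
    preserved-within (at₄ refl) (at₃ refl) = preserved-sym preserved-cd
    preserved-within (at₄ refl) (at₄ refl) = preserved-diag d

    φ-isomorphism : IsIso (adj G) (switchAdj G a b c d) (φ a c)
    φ-isomorphism = φ-bijective a c , preserved
      where
      preserved : ∀ x y → Preserved x y
      preserved x y with among? x a b c d | among? y a b c d
      ... | inj₂ x-out | _          = preserved-outside x-out y
      ... | inj₁ _     | inj₂ y-out = preserved-sym (preserved-outside y-out x)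
      ... | inj₁ x∈    | inj₁ y∈    = preserved-within x∈ y∈

  oppositeTwins⇒switchIso : OppositeTwins → SwitchIsoProperty G
  oppositeTwins⇒switchIso twins a b c d X =
    SwitchIso.φ-isomorphism twins X ,
    (φ-bijective b d , λ x y → trans (proj₂ (SwitchIso.φ-isomorphism twins (alt4-flip G X)) x y)
                                     (switchAdj-flip G a b c d (φ b d x) (φ b d y)))

  switchIso⇒oppositeTwins : SwitchIsoProperty G → OppositeTwins
  switchIso⇒oppositeTwins S {a} {b} {c} {d} {v} X v-out@(v≢a , _ , v≢c , _) = begin
    adj G a v                                ≡⟨ Graph.sym G a v ⟩
    adj G v a                                ≡⟨ proj₂ (proj₁ (S a b c d X)) v a ⟩
    switchAdj G a b c d (φ a c v) (φ a c a)  ≡⟨ cong₂ (switchAdj G a b c d) (φ-fixed v≢a v≢c) (φ-left a c) ⟩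
    switchAdj G a b c d v c                  ≡⟨ switchAdj-outside G v-out c ⟩
    adj G v c                                ≡⟨ Graph.sym G v c ⟩
    adj G c v                                ∎
    where open ≡-Reasoning

-- Matrogenic graphs versus opposite twins

module _ {n : ℕ} (G : Graph n) where
  open Alt4

  -- q must be a, the only neighbour of c here, and no vertex here but c is a non-neighbour of a.
  no-alt4-from : ∀ {a b c u q r s} → adj G a b ≡ true → adj G a u ≡ true →
                 adj G c b ≡ false → adj G c u ≡ false →
                 Alt4 G c q r s → Among q a b c u → Among r a b c u → ⊥
  no-alt4-from ab au cb cu W (at₁ refl) (at₁ refl) = b≢c W refl
  no-alt4-from ab au cb cu W (at₁ refl) (at₂ refl) = ≡true⇒≢false ab (bc∉E W)
  no-alt4-from ab au cb cu W (at₁ refl) (at₃ refl) = a≢c W refl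
  no-alt4-from ab au cb cu W (at₁ refl) (at₄ refl) = ≡true⇒≢false au (bc∉E W)
  no-alt4-from ab au cb cu W (at₂ refl) _          = ≡true⇒≢false (ab∈E W) cb
  no-alt4-from ab au cb cu W (at₃ refl) _          = a≢b W refl
  no-alt4-from ab au cb cu W (at₄ refl) _          = ≡true⇒≢false (ab∈E W) cu

  no-alt4-within : ∀ {a b c u S} → adj G a b ≡ true → adj G a u ≡ true →
                   adj G c b ≡ false → adj G c u ≡ false →
                   Distinct a b c u → AltSets G S → S ⊆ quad a b c u → ⊥
  no-alt4-within ab au cb cu D AS@(_ , _ , _ , _ , W , refl) S⊆
    with altSets-rooted G AS (quad-⊆-reverse (alt4-distinct G W) S⊆ (quad⁺ (at₃ refl)))
  ... | q , r , s , W′ , S≡cqrs =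
    no-alt4-from ab au cb cu W′ (quad⁻ (S⊆ (subst (q ∈_) (sym S≡cqrs) (quad⁺ (at₂ refl)))))
                                (quad⁻ (S⊆ (subst (r ∈_) (sym S≡cqrs) (quad⁺ (at₃ refl)))))

  matrogenic⇒no-forbidden : Matrogenic G → ∀ {a b c d u} → Alt4 G a b c d → Outside u a b c d →
                            adj G a u ≡ true → adj G c u ≡ false → ⊥
  matrogenic⇒no-forbidden (_ , _ , eliminate) {a} {b} {c} {d} {u} X (u≢a , u≢b , u≢c , _) au cu =
    let (_ , AZ , Z⊆) = eliminate (quad a b c d) (quad u a d c) d (_ , _ , _ , _ , X , refl)
                                  (_ , _ , _ , _ , Y , refl) X≢Y (quad⁺ (at₄ refl)) (quad⁺ (at₃ refl))
    in no-alt4-within (ab∈E X) au (adj-flip G (bc∉E X)) cu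
                      (distinct (a≢b X) (a≢c X) (≢-sym u≢a) (b≢c X) (≢-sym u≢b) (≢-sym u≢c))
                      AZ (λ v∈Z → within (Z⊆ v∈Z))
    where
    Y : Alt4 G u a d c
    Y = alt4 G (adj-flip G au) (adj-flip G (cd∈E X)) (ad∉E X) (adj-flip G cu) (a≢d X) u≢c

    b∉uadc : Among b u a d c → ⊥
    b∉uadc (at₁ b≡u) = u≢b (sym b≡u)
    b∉uadc (at₂ b≡a) = a≢b X (sym b≡a)
    b∉uadc (at₃ b≡d) = b≢d X b≡d
    b∉uadc (at₄ b≡c) = b≢c X b≡c

    X≢Y : quad a b c d ≢ quad u a d c
    X≢Y eq = b∉uadc (quad⁻ (subst (b ∈_) eq (quad⁺ (at₂ refl))))

    within : ∀ {v} → v ∈ (quad a b c d ∪ quad u a d c) - d → v ∈ quad a b c u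
    within v∈ with x∈p∪q⁻ (quad a b c d) _ (p─q⊆p _ _ v∈)
    ... | inj₁ v∈X with quad⁻ v∈X
    ...   | at₄ v≡d = ⊥-elim (x∈p-y⇒x≢y _ v∈ v≡d)
    ...   | at₁ v≡a = quad⁺ (at₁ v≡a)
    ...   | at₂ v≡b = quad⁺ (at₂ v≡b)
    ...   | at₃ v≡c = quad⁺ (at₃ v≡c)
    within v∈ | inj₂ v∈Y with quad⁻ v∈Y
    ...   | at₃ v≡d = ⊥-elim (x∈p-y⇒x≢y _ v∈ v≡d)
    ...   | at₁ v≡u = quad⁺ (at₄ v≡u)
    ...   | at₂ v≡a = quad⁺ (at₁ v≡a)
    ...   | at₄ v≡c = quad⁺ (at₃ v≡c)

  matrogenic⇒oppositeTwins : Matrogenic G → OppositeTwins G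
  matrogenic⇒oppositeTwins M {a} {b} {c} {d} {v} X v-out@(v≢a , v≢b , v≢c , v≢d)
    with adj G a v in av | adj G c v in cv
  ... | true  | true  = refl
  ... | false | false = refl
  ... | true  | false = ⊥-elim (matrogenic⇒no-forbidden M X v-out av cv)
  ... | false | true  =
    ⊥-elim (matrogenic⇒no-forbidden M (alt4-swap G X) (v≢c , v≢d , v≢a , v≢b) cv av)

  -- Circuit elimination from opposite twins

  AltSetIn : Subset n → Set
  AltSetIn T = ∃[ Z ] (AltSets G Z × Z ⊆ T)

  altSetIn : ∀ {T p q r s} → Alt4 G p q r s → p ∈ T → q ∈ T → r ∈ T → s ∈ T → AltSetIn T
  altSetIn W p∈ q∈ r∈ s∈ = _ , (_ , _ , _ , _ , W , refl) , quad-⊆ p∈ q∈ r∈ s∈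

  module Exchange (twins : OppositeTwins G) where

    twins-bd : ∀ {a b c d v} → Alt4 G a b c d → Outside v a b c d → adj G b v ≡ adj G d v
    twins-bd X (v≢a , v≢b , v≢c , v≢d) = twins (alt4-flip G X) (v≢b , v≢a , v≢d , v≢c)

    outside-neighbour : ∀ {a b c d v} → Alt4 G a b c d → adj G a v ≡ true →
                        v ≢ b → v ≢ c → Outside v a b c d
    outside-neighbour X av v≢b v≢c = ≢-sym (adjacent⇒≢ G av) , v≢b , v≢c , ≢-by-adj G av (ad∉E X)

    outside-non-neighbour : ∀ {a b c d v} → Alt4 G a b c d → adj G a v ≡ false →
                            v ≢ a → v ≢ c → v ≢ d → Outside v a b c d
    outside-non-neighbour X av v≢a v≢c v≢d = v≢a , ≢-sym (≢-by-adj G (ab∈E X) av) , v≢c , v≢d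

    diagonal-determines : ∀ {a b c d p r} → Alt4 G a b c d → Alt4 G a p c r → p ≡ b × r ≡ d
    diagonal-determines {b = b} {d = d} {p} {r} X Y =
      decidable-stable (p ≟ b) (λ p≢b →
        let p-out = outside-neighbour X (ab∈E Y) p≢b (b≢c Y)
        in ≡true⇒≢false (trans (sym (twins X p-out)) (ab∈E Y)) (adj-flip G (bc∉E Y))) ,
      decidable-stable (r ≟ d) (λ r≢d →
        let r-out = outside-non-neighbour X (ad∉E Y) (≢-sym (a≢d Y)) (≢-sym (c≢d Y)) r≢d
        in ≡true⇒≢false (cd∈E Y) (trans (sym (twins X r-out)) (ad∉E Y)))

    exchange-apex : ∀ {a b c d p q r} → Alt4 G a b c d → Alt4 G a p q r →
                    p ≢ b → r ≢ d → c ≢ p → c ≢ q → c ≢ r → Alt4 G c p q r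
    exchange-apex X Y p≢b r≢d c≢p c≢q c≢r =
      alt4 G (trans (sym (twins X p-out)) (ab∈E Y)) (cd∈E Y)
             (bc∉E Y) (trans (sym (twins X r-out)) (ad∉E Y)) (b≢c Y) c≢r
      where
      p-out = outside-neighbour X (ab∈E Y) p≢b (≢-sym c≢p)
      r-out = outside-non-neighbour X (ad∉E Y) (≢-sym (a≢d Y)) (≢-sym c≢r) r≢d

    exchange-edge : ∀ {a b c d q r} → Alt4 G a b c d → Alt4 G a b q r →
                    q ≢ c → q ≢ d → r ≢ c → r ≢ d → Alt4 G c d q r
    exchange-edge X Y q≢c q≢d r≢c r≢d =
      alt4 G (cd∈E X) (cd∈E Y)
             (trans (sym (twins-bd X q-out)) (bc∉E Y)) (trans (sym (twins X r-out)) (ad∉E Y))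
             (≢-sym q≢d) (≢-sym r≢c)
      where
      q-out = ≢-sym (a≢c Y) , ≢-sym (b≢c Y) , q≢c , q≢d
      r-out = outside-non-neighbour X (ad∉E Y) (≢-sym (a≢d Y)) r≢c r≢d

    exchange-edge-at-d : ∀ {a b c d r} → Alt4 G a b c d → Alt4 G a b d r → r ≢ c → Alt4 G c d b r
    exchange-edge-at-d X Y r≢c =
      alt4 G (cd∈E X) (trans (twins-bd X r-out) (cd∈E Y))
             (adj-flip G (bc∉E Y)) (trans (sym (twins X r-out)) (ad∉E Y))
             (≢-sym (b≢d X)) (≢-sym r≢c)
      where
      r-out = outside-non-neighbour X (ad∉E Y) (≢-sym (a≢d Y)) r≢c (≢-sym (c≢d Y))

    exchange-non-edge : ∀ {a b c d p q} → Alt4 G a b c d → Alt4 G a p q d →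
                        p ≢ b → p ≢ c → q ≢ b → q ≢ c → Alt4 G p c b q
    exchange-non-edge X Y p≢b p≢c q≢b q≢c =
      alt4 G (adj-flip G (trans (sym (twins X p-out)) (ab∈E Y)))
             (trans (twins-bd X q-out) (adj-flip G (cd∈E Y)))
             (adj-flip G (bc∉E X)) (bc∉E Y) (≢-sym (b≢c X)) (b≢c Y)
      where
      p-out = outside-neighbour X (ab∈E Y) p≢b p≢c
      q-out = ≢-sym (a≢c Y) , q≢b , q≢c , c≢d Y

    exchange-non-edge-at-b : ∀ {a b c d p} → Alt4 G a b c d → Alt4 G a p b d → p ≢ c →
                             Alt4 G b d p c
    exchange-non-edge-at-b X Y p≢c =
      alt4 G (cd∈E Y) (adj-flip G (trans (sym (twins X p-out)) (ab∈E Y)))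
             (trans (sym (twins-bd X p-out)) (adj-flip G (bc∉E Y))) (bc∉E X) (≢-sym (b≢d Y)) (b≢c X)
      where
      p-out = outside-neighbour X (ab∈E Y) (b≢c Y) p≢c

    exchange-crossed-at-c : ∀ {a b c d r} → Alt4 G a b c d → Alt4 G a c b r → r ≢ d → Alt4 G c d b r
    exchange-crossed-at-c X Y r≢d =
      alt4 G (cd∈E X) (cd∈E Y) (adj-flip G (trans (sym (twins Y d-out)) (ad∉E X)))
             (trans (sym (twins X r-out)) (ad∉E Y)) (≢-sym (b≢d X)) (b≢d Y)
      where
      r-out = outside-non-neighbour X (ad∉E Y) (≢-sym (a≢d Y)) (≢-sym (b≢d Y)) r≢d
      d-out = ≢-sym (a≢d X) , ≢-sym (c≢d X) , ≢-sym (b≢d X) , ≢-sym r≢d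

    exchange-crossed-at-d : ∀ {a b c d p} → Alt4 G a b c d → Alt4 G a p d c → p ≢ b → Alt4 G b d p c
    exchange-crossed-at-d X Y p≢b =
      alt4 G (adj-flip G (trans (sym (twins Y b-out)) (ab∈E X)))
             (adj-flip G (trans (sym (twins X p-out)) (ab∈E Y)))
             (adj-flip G (bc∉E Y)) (bc∉E X) (≢-sym (b≢c Y)) (b≢c X)
      where
      p-out = outside-neighbour X (ab∈E Y) p≢b (b≢d Y)
      b-out = ≢-sym (a≢b X) , ≢-sym p≢b , b≢d X , b≢c X

    module _ {T : Subset n} where

      eliminate-apart : ∀ {a b c d p q r} → Alt4 G a b c d → Alt4 G a p q r →
                        c ≢ p → c ≢ q → c ≢ r →
                        b ∈ T → c ∈ T → d ∈ T → p ∈ T → q ∈ T → r ∈ T → AltSetIn T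
      eliminate-apart {b = b} {d = d} {p} {q} {r} X Y c≢p c≢q c≢r bT cT dT pT qT rT
        with p ≟ b | r ≟ d
      ... | no p≢b   | no r≢d   = altSetIn (exchange-apex X Y p≢b r≢d c≢p c≢q c≢r) cT pT qT rT
      ... | yes refl | yes refl =
        ⊥-elim (c≢q (sym (proj₂ (diagonal-determines (alt4-flip G X) (alt4-flip G Y)))))
      ... | yes refl | no r≢d with q ≟ d
      ...   | yes refl = altSetIn (exchange-edge-at-d X Y (≢-sym c≢r)) cT dT pT rT
      ...   | no q≢d   = altSetIn (exchange-edge X Y (≢-sym c≢q) q≢d (≢-sym c≢r) r≢d) cT dT qT rT
      eliminate-apart {b = b} {q = q} X Y c≢p c≢q c≢r bT cT dT pT qT rT | no p≢b | yes refl
        with q ≟ b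
      ...   | yes refl = altSetIn (exchange-non-edge-at-b X Y (≢-sym c≢p)) bT dT pT cT
      ...   | no q≢b   =
        altSetIn (exchange-non-edge X Y p≢b (≢-sym c≢p) q≢b (≢-sym c≢q)) pT cT bT qT

      eliminate-crossing : ∀ {a b c d p q r} → Alt4 G a b c d → Alt4 G a p q r →
                           Among₃ c p q r → Among₃ q b c d →
                           ¬ (Among₃ b p q r × Among₃ c p q r × Among₃ d p q r) →
                           b ∈ T → c ∈ T → d ∈ T → p ∈ T → r ∈ T → AltSetIn T
      eliminate-crossing X Y _ (inj₂ (inj₁ refl)) new _ _ _ _ _ with diagonal-determines X Y
      ... | refl , refl = ⊥-elim (new (inj₁ refl , inj₂ (inj₁ refl) , inj₂ (inj₂ refl)))
      eliminate-crossing {d = d} {r = r} X Y (inj₁ refl) (inj₁ refl) new bT cT dT pT rT with r ≟ d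
      ... | yes refl = ⊥-elim (new (inj₂ (inj₁ refl) , inj₁ refl , inj₂ (inj₂ refl)))
      ... | no r≢d   = altSetIn (exchange-crossed-at-c X Y r≢d) cT dT bT rT
      eliminate-crossing X Y (inj₂ (inj₁ refl)) (inj₁ refl) _ _ _ _ _ _ = ⊥-elim (b≢c X refl)
      eliminate-crossing X Y (inj₂ (inj₂ refl)) (inj₁ refl) _ _ _ _ _ _ =
        ⊥-elim (≡true⇒≢false (cd∈E Y) (bc∉E X))
      eliminate-crossing X Y (inj₁ refl) (inj₂ (inj₂ refl)) _ _ _ _ _ _ =
        ⊥-elim (≡true⇒≢false (cd∈E X) (bc∉E Y))
      eliminate-crossing X Y (inj₂ (inj₁ refl)) (inj₂ (inj₂ refl)) _ _ _ _ _ _ = ⊥-elim (c≢d X refl)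
      eliminate-crossing {b = b} {p = p} X Y (inj₂ (inj₂ refl)) (inj₂ (inj₂ refl)) new bT cT dT pT rT
        with p ≟ b
      ... | yes refl = ⊥-elim (new (inj₁ refl , inj₂ (inj₂ refl) , inj₂ (inj₁ refl)))
      ... | no p≢b   = altSetIn (exchange-crossed-at-d X Y p≢b) bT dT pT cT

      eliminate : ∀ {a b c d p q r} → Alt4 G a b c d → Alt4 G a p q r →
                  ¬ (Among₃ b p q r × Among₃ c p q r × Among₃ d p q r) →
                  b ∈ T → c ∈ T → d ∈ T → p ∈ T → q ∈ T → r ∈ T → AltSetIn T
      eliminate {b = b} {c} {d} {p = p} {q} {r} X Y new bT cT dT pT qT rT
        with among₃? c p q r | among₃? q b c d
      ... | inj₂ (c≢p , c≢q , c≢r) | _ = eliminate-apart X Y c≢p c≢q c≢r bT cT dT pT qT rT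
      ... | inj₁ _ | inj₂ (q≢b , q≢c , q≢d) = eliminate-apart Y X q≢b q≢c q≢d pT qT rT bT cT dT
      ... | inj₁ c∈pqr | inj₁ q∈bcd = eliminate-crossing X Y c∈pqr q∈bcd new bT cT dT pT rT

  altSets-elimination : OppositeTwins G → ∀ S S′ (e : Fin n) → AltSets G S → AltSets G S′ →
                        S ≢ S′ → e ∈ S → e ∈ S′ → AltSetIn ((S ∪ S′) - e)
  altSets-elimination twins S S′ e AS AS′ S≢S′ e∈S e∈S′
    with altSets-rooted G AS e∈S | altSets-rooted G AS′ e∈S′
  ... | b , c , d , X , refl | p , q , r , Y , refl =
    eliminate X Y new (inT (inj₁ (at₂ refl)) (a≢b X)) (inT (inj₁ (at₃ refl)) (a≢c X))
                      (inT (inj₁ (at₄ refl)) (a≢d X)) (inT (inj₂ (at₂ refl)) (a≢b Y))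
                      (inT (inj₂ (at₃ refl)) (a≢c Y)) (inT (inj₂ (at₄ refl)) (a≢d Y))
    where
    open Exchange twins

    inT : ∀ {v} → Among v e b c d ⊎ Among v e p q r → e ≢ v →
          v ∈ (quad e b c d ∪ quad e p q r) - e
    inT v∈ e≢v = x∈p∧x≢y⇒x∈p-y (x∈p∪q⁺ (Sum.map quad⁺ quad⁺ v∈)) (≢-sym e≢v)

    new : ¬ (Among₃ b p q r × Among₃ c p q r × Among₃ d p q r)
    new (b∈ , c∈ , d∈) = S≢S′ (altSets-⊆⇒≡ G _ _ AS AS′
      (quad-⊆ (quad⁺ (at₁ refl)) (quad⁺ (inj₂ b∈)) (quad⁺ (inj₂ c∈)) (quad⁺ (inj₂ d∈))))

lemma3p2 : {n : ℕ} (G : Graph n) → Matrogenic G ⇔ SwitchIsoProperty G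
lemma3p2 G = mk⇔
  (λ matrogenic → oppositeTwins⇒switchIso G (matrogenic⇒oppositeTwins G matrogenic))
  (λ switchIso → altSets-nonempty G , altSets-⊆⇒≡ G ,
                 altSets-elimination G (switchIso⇒oppositeTwins G switchIso))
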